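{- If $G$ is a finite simple graph with minimum degree $\delta\ge 2$ and average degree $d$, then $\mathrm{MOF}(G) \geq \big \lfloor \frac{d+1}{4} \big \rfloor$.
   Context: An orientation $D$ of a simple graph $G$ assigns to each edge exactly one direction; if $(u,v)$ is an arc, $v$ is an out-neighbor of $u$. Oriented $1$-forcing: starting from a nonempty set $S$ of colored vertices, repeatedly, any colored vertex with at most one non-colored out-neighbor forces that out-neighbor to become colored (all forcings in a step simultaneous), until no change occurs; $S$ is a forcing set if all vertices end up colored. $F(D)$ is the minimum size of a forcing set of $D$, and $\mathrm{MOF}(G)$ is the maximum of $F(D)$ over all orientations $D$ of $G$. -}

module Defs where

open import Data.Nat using (ℕ; zero; suc; _+_; _*_; _≤_; _/_)
open import Data.Bool using (Bool; true; false; _∧_; _∨_; not; if_then_else_)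
open import Data.Fin using (Fin)
open import Data.Fin.Subset using (Subset; _∈_; ∣_∣)
open import Data.Vec using (Vec; tabulate; lookup)
open import Data.List using (List; foldr; filterᵇ; length)
open import Data.List using (allFin) renaming (map to lmap)
open import Data.Nat.Base using (_≤ᵇ_)
open import Data.Product using (_×_)
open import Relation.Binary.PropositionalEquality using (_≡_)

record SimpleGraph (n : ℕ) : Set where
  field
    adj    : Fin n → Fin n → Bool
    symm   : ∀ u v → adj u v ≡ adj v u
    irrefl : ∀ v → adj v v ≡ false
open SimpleGraph public

countᵇ : ∀ {n} → (Fin n → Bool) → ℕ
countᵇ {n} p = length (filterᵇ p (allFin n))

degree : ∀ {n} → SimpleGraph n → Fin n → ℕ
degree G v = countᵇ (adj G v)

degreeSum : ∀ {n} → SimpleGraph n → ℕ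
degreeSum {n} G = foldr _+_ 0 (lmap (degree G) (allFin n))

record Orientation {n : ℕ} (G : SimpleGraph n) : Set where
  field
    arc       : Fin n → Fin n → Bool
    arc⇒adj   : ∀ u v → arc u v ≡ true → adj G u v ≡ true
    oneWay    : ∀ u v → adj G u v ≡ true → arc u v ≡ true → arc v u ≡ false
    someWay   : ∀ u v → adj G u v ≡ true → arc u v ≡ false → arc v u ≡ true
open Orientation public

col : ∀ {n} → Subset n → Fin n → Bool
col c v = lookup c v

uncolOut : ∀ {n} {G : SimpleGraph n} → Orientation G → Subset n → Fin n → ℕ
uncolOut D c u = countᵇ (λ w → arc D u w ∧ not (col c w))

forcedᵇ : ∀ {n} {G : SimpleGraph n} → Orientation G → Subset n → Fin n → Bool
forcedᵇ {n} D c v =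
  foldr _∨_ false
    (lmap (λ u → col c u ∧ arc D u v ∧ not (col c v) ∧ (uncolOut D c u ≤ᵇ 1))
          (allFin n))

forceStep : ∀ {n} {G : SimpleGraph n} → Orientation G → Subset n → Subset n
forceStep D c = tabulate (λ v → col c v ∨ forcedᵇ D c v)

iterate : ∀ {A : Set} → ℕ → (A → A) → A → A
iterate zero    f a = a
iterate (suc k) f a = iterate k f (f a)

-- final colouring: each non-final step colours at least one new vertex, so
-- after n steps the process has stabilised.
closure : ∀ {n} {G : SimpleGraph n} → Orientation G → Subset n → Subset n
closure {n} D S = iterate n (forceStep D) S

IsForcingSet : ∀ {n} {G : SimpleGraph n} → Orientation G → Subset n → Set
IsForcingSet {n} D S = (1 ≤ ∣ S ∣) × (∀ v → v ∈ closure D S)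

F≥ : ∀ {n} {G : SimpleGraph n} → Orientation G → ℕ → Set
F≥ D k = ∀ S → IsForcingSet D S → k ≤ ∣ S ∣

module Submission where

-- Call C a core of an orientation if no arc enters C and every vertex of C has at
-- least k out-neighbours in C. If C is nonempty, no set S with |S| < k forces: a coloured
-- vertex of C has at least k − (|S| − 1) ≥ 2 uncoloured out-neighbours in C, so no vertex
-- of C ∖ S is ever coloured.
-- A core exists as soon as |E| > k n. Starting from any orientation, reverse directed
-- paths from a vertex of out-degree > k to one of out-degree < k; each reversal lowers the
-- deficit Σ (k ∸ outdeg). When this stops, the vertices that reach a vertex of out-degree
-- < k have out-degree ≤ k and are closed under predecessors; the remaining vertices, once
-- the edges between them and the rest point outwards, form a core, nonempty because otherwise
-- 2|E| ≤ 2 k n. For k = ⌊(d + 1)/4⌋ ≥ 1 we have d ≥ 3k, hence |E| = n d / 2 > k n.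

open import Defs
open import Data.Nat using (ℕ; suc; _+_; _*_; _≤_; _/_)
open import Data.Fin using (Fin)
open import Data.Product using (Σ)

open import Data.Bool using (Bool; true; false; not; _∧_; _∨_; _xor_; if_then_else_)
open import Data.Bool.Properties as Bool using (∨-comm; ∧-zeroʳ; not-injective; not-¬; not-distribʳ-xor)
open import Data.Empty using (⊥-elim)
open import Data.Fin using (zero; suc; punchIn; _≟_)
open import Data.Fin.Properties as Fin using (punchInᵢ≢i; any?)
open import Data.Fin.Subset using (Subset; ∣_∣)
open import Data.List using (List; []; _∷_; allFin; length; filterᵇ; foldr; tabulate) renaming (map to lmap)
open import Data.Nat using (zero; _<_; _∸_; z≤n; s≤s; z<s; _≤ᵇ_; _≤?_; _<?_)
open import Data.Nat.DivMod using (m/n*n≤m)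
open import Data.Nat.Induction using (<-wellFounded)
open import Data.Nat.Properties
  using ( +-0-commutativeMonoid; +-commutativeSemigroup; module ≤-Reasoning
        ; ≤-refl; ≤-reflexive; ≤-trans; ≤-pred; <-≤-trans; <-asym; ≮⇒≥; ≰⇒>; <⇒≱; n≤1+n
        ; +-comm; +-suc; +-identityʳ; *-identityʳ; +-mono-≤; +-monoˡ-≤; +-monoʳ-≤; +-mono-<-≤
        ; +-cancelˡ-≤; +-cancelʳ-≤; m<m+n; m≤m*n; m≤n⇒m∸n≡0; ∸-monoʳ-≤; ∸-monoʳ-< )
open import Data.Nat.Tactic.RingSolver using (solve-∀)
open import Data.Product using (_×_; _,_; ∃-syntax; proj₁; proj₂)
open import Data.Vec as Vec using (lookup)
open import Data.Vec.Properties using (lookup∘tabulate; []=⇒lookup)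
open import Function using (_∘_)
open import Induction.WellFounded using (Acc; acc)
open import Relation.Binary.Definitions using (tri<; tri≈; tri>)
open import Relation.Binary.PropositionalEquality
open import Relation.Nullary using (¬_; Dec; yes; no; contradiction; _×-dec_; ¬?)
open import Relation.Nullary.Decidable using (does; dec-true; dec-false; decidable-stable)
import Relation.Unary as U

open import Algebra.Properties.CommutativeMonoid.Sum +-0-commutativeMonoid
  using (sum; sum-cong-≗; sum-remove; ∑-distrib-+; ∑-comm)
open import Algebra.Properties.CommutativeSemigroup +-commutativeSemigroup using (xy∙z≈xz∙y)

indicator : Bool → ℕ
indicator true  = 1
indicator false = 0

count : ∀ {n} → (Fin n → Bool) → ℕ
count p = sum (indicator ∘ p)

sum-mono-≤ : ∀ {n} {f g : Fin n → ℕ} → (∀ i → f i ≤ g i) → sum f ≤ sum g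
sum-mono-≤ {zero}  f≤g = z≤n
sum-mono-≤ {suc n} f≤g = +-mono-≤ (f≤g zero) (sum-mono-≤ (f≤g ∘ suc))

sum-≤-* : ∀ {n} (f : Fin n → ℕ) {c} → (∀ i → f i ≤ c) → sum f ≤ n * c
sum-≤-* {zero}  f f≤c = z≤n
sum-≤-* {suc n} f f≤c = +-mono-≤ (f≤c zero) (sum-≤-* (f ∘ suc) (f≤c ∘ suc))

sum-mono-< : ∀ {n} {f g : Fin n → ℕ} → (∀ i → f i ≤ g i) → ∀ c → f c < g c → sum f < sum g
sum-mono-< {suc n} {f} {g} f≤g c fc<gc = begin-strict
  sum f                     ≡⟨ sum-remove f ⟩
  f c + sum (f ∘ punchIn c) <⟨ +-mono-<-≤ fc<gc (sum-mono-≤ (f≤g ∘ punchIn c)) ⟩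
  g c + sum (g ∘ punchIn c) ≡⟨ sum-remove g ⟨
  sum g                     ∎
  where open ≤-Reasoning

_⊆ᵇ_ : ∀ {n} → (Fin n → Bool) → (Fin n → Bool) → Set
p ⊆ᵇ q = ∀ i → p i ≡ true → q i ≡ true

indicator-mono : ∀ {a b} → (a ≡ true → b ≡ true) → indicator a ≤ indicator b
indicator-mono {false}          _   = z≤n
indicator-mono {true}  {true}   _   = ≤-refl
indicator-mono {true}  {false} a⇒b with a⇒b refl
... | ()

count-mono : ∀ {n} {p q : Fin n → Bool} → p ⊆ᵇ q → count p ≤ count q
count-mono p⊆q = sum-mono-≤ (λ i → indicator-mono (p⊆q i))

count-≤ : ∀ {n} (p : Fin n → Bool) → count p ≤ n
count-≤ {n} p = subst (count p ≤_) (*-identityʳ n) (sum-≤-* (indicator ∘ p) (λ i → indicator≤1 (p i)))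
  where
  indicator≤1 : ∀ b → indicator b ≤ 1
  indicator≤1 true  = ≤-refl
  indicator≤1 false = z≤n

count-mono-< : ∀ {n} {p q : Fin n → Bool} → p ⊆ᵇ q → ∀ c → p c ≡ false → q c ≡ true →
               count p < count q
count-mono-< p⊆q c pc qc = sum-mono-< (λ i → indicator-mono (p⊆q i)) c
  (subst₂ (λ a b → indicator a < indicator b) (sym pc) (sym qc) ≤-refl)

count+indicator≤count : ∀ {n} {p q : Fin n → Bool} → p ⊆ᵇ q → ∀ c → p c ≡ false →
                        count p + indicator (q c) ≤ count q
count+indicator≤count {p = p} {q} p⊆q c pc with q c in qc
... | true  = subst (_≤ count q) (+-comm 1 (count p)) (count-mono-< p⊆q c pc qc)
... | false = subst (_≤ count q) (sym (+-identityʳ (count p))) (count-mono p⊆q)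

count-insert : ∀ {n} {p q : Fin n → Bool} c → (∀ i → i ≢ c → p i ≡ q i) → p c ≡ false → q c ≡ true →
               count q ≡ suc (count p)
count-insert {suc n} {p} {q} c p≗q pc qc = begin
  count q                                   ≡⟨ sum-remove (indicator ∘ q) ⟩
  indicator (q c) + count (q ∘ punchIn c)   ≡⟨ cong₂ (λ a b → indicator a + b) qc (sym (sum-cong-≗ off-c)) ⟩
  suc (count (p ∘ punchIn c))               ≡⟨ cong (λ a → suc (indicator a + count (p ∘ punchIn c))) pc ⟨
  suc (indicator (p c) + count (p ∘ punchIn c)) ≡⟨ cong suc (sum-remove (indicator ∘ p)) ⟨
  suc (count p)                             ∎
  where
  open ≡-Reasoning
  off-c : ∀ j → indicator (p (punchIn c j)) ≡ indicator (q (punchIn c j))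
  off-c j = cong indicator (p≗q _ (punchInᵢ≢i c j))

count-split : ∀ {n} (p q : Fin n → Bool) →
              count p ≡ count (λ i → p i ∧ q i) + count (λ i → p i ∧ not (q i))
count-split p q =
  trans (sum-cong-≗ (λ i → split (p i) (q i)))
        (∑-distrib-+ (λ i → indicator (p i ∧ q i)) (λ i → indicator (p i ∧ not (q i))))
  where
  split : ∀ a b → indicator a ≡ indicator (a ∧ b) + indicator (a ∧ not b)
  split true  true  = refl
  split true  false = refl
  split false _     = refl

count-witness : ∀ {n} (p : Fin n → Bool) → 0 < count p → ∃[ i ] p i ≡ true
count-witness {suc n} p pos with p zero in p0
... | true  = zero , p0
... | false with count-witness (p ∘ suc) pos
...   | i , pi = suc i , pi

does-true⁻ : ∀ {A : Set} (a? : Dec A) → does a? ≡ true → A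
does-true⁻ (yes a) _ = a

stabilise : ∀ {n} (P : ℕ → Fin n → Set) → (∀ j → U.Decidable (P j)) →
            (∀ {j u} → P j u → P (suc j) u) → ∃[ j ] (∀ {u} → P (suc j) u → P j u)
stabilise {n} P P? grow = go 0 (<-wellFounded (n ∸ size 0))
  where
  size : ℕ → ℕ
  size j = count (λ u → does (P? j u))
  go : ∀ j → Acc _<_ (n ∸ size j) → ∃[ j ] (∀ {u} → P (suc j) u → P j u)
  go j (acc smaller) with any? (λ u → P? (suc j) u ×-dec ¬? (P? j u))
  ... | no  none            = j , λ {u} new → decidable-stable (P? j u) (λ old → none (u , new , old))
  ... | yes (u , new , old) = go (suc j) (smaller (∸-monoʳ-< size-grows (count-≤ _)))
    where
    size-grows : size j < size (suc j)
    size-grows = count-mono-< (λ v → dec-true (P? (suc j) v) ∘ grow ∘ does-true⁻ (P? j v)) u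
                              (dec-false (P? j u) old) (dec-true (P? (suc j) u) new)

∧-≡-true⁻ : ∀ {a b} → a ∧ b ≡ true → a ≡ true × b ≡ true
∧-≡-true⁻ {true} b≡true = refl , b≡true

∧-≡-true⁺ : ∀ {a b} → a ≡ true → b ≡ true → a ∧ b ≡ true
∧-≡-true⁺ refl b≡true = b≡true

length-filterᵇ-tabulate : ∀ {A : Set} (p : A → Bool) {m} (f : Fin m → A) →
                          length (filterᵇ p (tabulate f)) ≡ count (p ∘ f)
length-filterᵇ-tabulate p {zero}  f = refl
length-filterᵇ-tabulate p {suc m} f with p (f zero)
... | true  = cong suc (length-filterᵇ-tabulate p (f ∘ suc))
... | false = length-filterᵇ-tabulate p (f ∘ suc)

countᵇ≡count : ∀ {n} (p : Fin n → Bool) → countᵇ p ≡ count p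
countᵇ≡count p = length-filterᵇ-tabulate p (λ i → i)

foldr-+-map-tabulate : ∀ {A : Set} (g : A → ℕ) {m} (f : Fin m → A) →
                       foldr _+_ 0 (lmap g (tabulate f)) ≡ sum (g ∘ f)
foldr-+-map-tabulate g {zero}  f = refl
foldr-+-map-tabulate g {suc m} f = cong (g (f zero) +_) (foldr-+-map-tabulate g (f ∘ suc))

∣∣≡count : ∀ {n} (S : Subset n) → ∣ S ∣ ≡ count (lookup S)
∣∣≡count Vec.[]          = refl
∣∣≡count (true Vec.∷ S)  = cong suc (∣∣≡count S)
∣∣≡count (false Vec.∷ S) = ∣∣≡count S

foldr-∨-map-false : ∀ {A : Set} (f : A → Bool) (xs : List A) → (∀ x → f x ≡ false) →
                    foldr _∨_ false (lmap f xs) ≡ false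
foldr-∨-map-false f []       f≡false = refl
foldr-∨-map-false f (x ∷ xs) f≡false rewrite f≡false x = foldr-∨-map-false f xs f≡false

arc-irrefl : ∀ {n} {G : SimpleGraph n} (D : Orientation G) u → arc D u u ≡ false
arc-irrefl {G = G} D u with arc D u u in uu
... | false = refl
... | true with trans (sym (arc⇒adj D u u uu)) (irrefl G u)
...   | ()

≤ᵇ1-false : ∀ {x} → 2 ≤ x → (x ≤ᵇ 1) ≡ false
≤ᵇ1-false (s≤s (s≤s _)) = refl

module _ {n} {G : SimpleGraph n} (D : Orientation G) (k : ℕ) where

  record Core : Set where
    field
      member      : Fin n → Bool
      pred-closed : ∀ u v → arc D u v ≡ true → member v ≡ true → member u ≡ true
      out-degree  : ∀ u → member u ≡ true → k ≤ count (λ w → arc D u w ∧ member w)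

  module Barrier (core : Core) (S : Subset n) (S<k : ∣ S ∣ < k) where
    open Core core

    coreArc : Fin n → Fin n → Bool
    coreArc u w = arc D u w ∧ member w

    free : Fin n → ℕ
    free u = count (λ w → coreArc u w ∧ not (lookup S w))

    free-bound : ∀ u → member u ≡ true → suc (indicator (lookup S u)) ≤ free u
    free-bound u u∈C = +-cancelˡ-≤ ∣ S ∣ _ _ (begin
      ∣ S ∣ + suc (indicator (lookup S u))         ≡⟨ +-suc ∣ S ∣ _ ⟩
      suc ∣ S ∣ + indicator (lookup S u)           ≤⟨ +-monoˡ-≤ _ S<k ⟩
      k + indicator (lookup S u)                   ≤⟨ +-monoˡ-≤ _ (out-degree u u∈C) ⟩
      count (coreArc u) + indicator (lookup S u)   ≡⟨ cong (_+ _) (count-split (coreArc u) (lookup S)) ⟩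
      count inS + free u + indicator (lookup S u)  ≡⟨ xy∙z≈xz∙y (count inS) (free u) _ ⟩
      count inS + indicator (lookup S u) + free u  ≤⟨ +-monoˡ-≤ (free u) inS+u≤S ⟩
      ∣ S ∣ + free u                               ∎)
      where
      open ≤-Reasoning
      inS : Fin n → Bool
      inS w = coreArc u w ∧ lookup S w
      inS+u≤S : count inS + indicator (lookup S u) ≤ ∣ S ∣
      inS+u≤S = subst (count inS + indicator (lookup S u) ≤_) (sym (∣∣≡count S))
        (count+indicator≤count (λ w → proj₂ ∘ ∧-≡-true⁻ {coreArc u w}) u
                               (cong (λ a → (a ∧ member u) ∧ lookup S u) (arc-irrefl D u)))

    Agrees : Subset n → Set
    Agrees c = ∀ w → member w ≡ true → col c w ≡ lookup S w

    uncolOut-≥2 : ∀ c → Agrees c → ∀ u → member u ≡ true → lookup S u ≡ true → 2 ≤ uncolOut D c u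
    uncolOut-≥2 c agree u u∈C u∈S = begin
      2                                          ≤⟨ subst (λ b → suc (indicator b) ≤ free u) u∈S (free-bound u u∈C) ⟩
      free u                                     ≤⟨ count-mono free⇒uncoloured ⟩
      count (λ w → arc D u w ∧ not (col c w))    ≡⟨ countᵇ≡count (λ w → arc D u w ∧ not (col c w)) ⟨
      uncolOut D c u                             ∎
      where
      open ≤-Reasoning
      free⇒uncoloured : ∀ w → (coreArc u w ∧ not (lookup S w)) ≡ true → (arc D u w ∧ not (col c w)) ≡ true
      free⇒uncoloured w h with ∧-≡-true⁻ {coreArc u w} h
      ... | uw∧w∈C , w∉S with ∧-≡-true⁻ {arc D u w} uw∧w∈C
      ...   | uw , w∈C = ∧-≡-true⁺ uw (trans (cong not (agree w w∈C)) w∉S)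

    forceStep-agrees : ∀ c → Agrees c → Agrees (forceStep D c)
    forceStep-agrees c agree w w∈C with lookup S w in Sw
    ... | true  = trans (lookup∘tabulate _ w) (cong (_∨ forcedᵇ D c w) (trans (agree w w∈C) Sw))
    ... | false = trans (lookup∘tabulate _ w) (cong₂ _∨_ cw (foldr-∨-map-false _ (allFin n) unforced))
      where
      cw : col c w ≡ false
      cw = trans (agree w w∈C) Sw
      unforced : ∀ u → (col c u ∧ arc D u w ∧ not (col c w) ∧ (uncolOut D c u ≤ᵇ 1)) ≡ false
      unforced u with col c u in cu | arc D u w in uw
      ... | false | _     = refl
      ... | true  | false = refl
      ... | true  | true  rewrite cw = ≤ᵇ1-false (uncolOut-≥2 c agree u u∈C (trans (sym (agree u u∈C)) cu))
        where
        u∈C : member u ≡ true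
        u∈C = pred-closed u w uw w∈C

    iterate-agrees : ∀ m c → Agrees c → Agrees (iterate m (forceStep D) c)
    iterate-agrees zero    c agree = agree
    iterate-agrees (suc m) c agree = iterate-agrees m (forceStep D c) (forceStep-agrees c agree)

    closure-misses : ∃[ x ] member x ≡ true → ∃[ w ] col (closure D S) w ≡ false
    closure-misses (x , x∈C) with count-witness _ (≤-trans (s≤s z≤n) (free-bound x x∈C))
    ... | w , h with ∧-≡-true⁻ {coreArc x w} h
    ...   | xw∧w∈C , w∉S =
      w , trans (iterate-agrees n S (λ _ _ → refl) w (proj₂ (∧-≡-true⁻ {arc D x w} xw∧w∈C))) (not-injective w∉S)

  core⇒F≥ : (core : Core) → ∃[ x ] Core.member core x ≡ true → F≥ D k
  core⇒F≥ core nonempty S (_ , covered) with k ≤? ∣ S ∣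
  ... | yes k≤S = k≤S
  ... | no  k≰S with Barrier.closure-misses core S (≰⇒> k≰S) nonempty
  ...   | w , missed = contradiction ([]=⇒lookup (covered w)) (not-¬ missed)

Direction : ℕ → Set
Direction n = Fin n → Fin n → Bool

module _ {n} (G : SimpleGraph n) where

  IsOrientation : Direction n → Set
  IsOrientation d = ∀ u v → adj G u v ≡ true → d v u ≡ not (d u v)

  arcOf : Direction n → Fin n → Fin n → Bool
  arcOf d u v = adj G u v ∧ d u v

  outDeg : Direction n → Fin n → ℕ
  outDeg d u = count (arcOf d u)

  adj⇒≢ : ∀ {u v} → adj G u v ≡ true → u ≢ v
  adj⇒≢ {u} uv refl = not-¬ (irrefl G u) uv

  toOrientation : ∀ {d} → IsOrientation d → Orientation G
  toOrientation {d} valid = record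
    { arc     = arcOf d
    ; arc⇒adj = λ u v → proj₁ ∘ ∧-≡-true⁻
    ; oneWay  = λ u v uv uv∈d →
        trans (cong (adj G v u ∧_) (trans (valid u v uv) (cong not (proj₂ (∧-≡-true⁻ uv∈d))))) (∧-zeroʳ (adj G v u))
    ; someWay = λ u v uv uv∉d → cong₂ _∧_ (trans (symm G v u) uv)
                                      (trans (valid u v uv) (cong not (trans (sym (cong (_∧ d u v) uv)) uv∉d)))
    }

  byIndex : Direction n
  byIndex u v = does (u Fin.<? v)

  byIndex-orientation : IsOrientation byIndex
  byIndex-orientation u v uv with Fin.<-cmp u v
  ... | tri< u<v _ v≮u = trans (dec-false (v Fin.<? u) v≮u) (cong not (sym (dec-true (u Fin.<? v) u<v)))
  ... | tri≈ _ u≡v _   = ⊥-elim (adj⇒≢ uv u≡v)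
  ... | tri> u≮v _ v<u = trans (dec-true (v Fin.<? u) v<u) (cong not (sym (dec-false (u Fin.<? v) u≮v)))

  joins : Fin n → Fin n → Fin n → Fin n → Bool
  joins a b x y = (does (x ≟ a) ∧ does (y ≟ b)) ∨ (does (y ≟ a) ∧ does (x ≟ b))

  joins-sym : ∀ a b x y → joins a b y x ≡ joins a b x y
  joins-sym a b x y = ∨-comm (does (y ≟ a) ∧ does (x ≟ b)) (does (x ≟ a) ∧ does (y ≟ b))

  joins-self : ∀ a b → joins a b a b ≡ true
  joins-self a b with a ≟ a | b ≟ b
  ... | yes _   | yes _   = refl
  ... | no a≢a  | _       = ⊥-elim (a≢a refl)
  ... | yes _   | no b≢b  = ⊥-elim (b≢b refl)

  reverse : Direction n → Fin n → Fin n → Direction n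
  reverse d a b x y = joins a b x y xor d x y

  reverse-orientation : ∀ {d} a b → IsOrientation d → IsOrientation (reverse d a b)
  reverse-orientation {d} a b valid u v uv = begin
    joins a b v u xor d v u       ≡⟨ cong₂ _xor_ (joins-sym a b u v) (valid u v uv) ⟩
    joins a b u v xor not (d u v) ≡⟨ not-distribʳ-xor (joins a b u v) (d u v) ⟨
    not (joins a b u v xor d u v) ∎
    where open ≡-Reasoning

  reverse-outside : ∀ d {a b x y} → ¬ (x ≡ a × y ≡ b) → ¬ (y ≡ a × x ≡ b) → reverse d a b x y ≡ d x y
  reverse-outside d {a} {b} {x} {y} ¬ab ¬ba with x ≟ a | y ≟ b | y ≟ a | x ≟ b
  ... | yes x≡a | yes y≡b | _       | _       = ⊥-elim (¬ab (x≡a , y≡b))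
  ... | _       | _       | yes y≡a | yes x≡b = ⊥-elim (¬ba (y≡a , x≡b))
  ... | no _    | _       | no _    | _       = refl
  ... | no _    | _       | yes _   | no _    = refl
  ... | yes _   | no _    | no _    | _       = refl
  ... | yes _   | no _    | yes _   | no _    = refl

  redirect : (Fin n → Bool) → Direction n → Direction n
  redirect χ d u v = if χ u xor χ v then χ u else d u v

  redirect-orientation : ∀ χ {d} → IsOrientation d → IsOrientation (redirect χ d)
  redirect-orientation χ valid u v uv with χ u | χ v
  ... | true  | true  = valid u v uv
  ... | true  | false = refl
  ... | false | true  = refl
  ... | false | false = valid u v uv

  redirect-pred-closed : ∀ χ d u v → arcOf (redirect χ d) u v ≡ true → χ v ≡ true → χ u ≡ true
  redirect-pred-closed χ d u v uv v∈χ with χ u | χ v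
  ... | true  | _     = refl
  ... | false | true  = contradiction (trans (sym (∧-zeroʳ (adj G u v))) uv) λ ()
  ... | false | false = v∈χ

  module Reversal {d} (valid : IsOrientation d) {a b} (ab : arcOf d a b ≡ true) where
    d′ : Direction n
    d′ = reverse d a b

    private
      adj-ab : adj G a b ≡ true
      adj-ab = proj₁ (∧-≡-true⁻ ab)
      adj-ba : adj G b a ≡ true
      adj-ba = trans (symm G b a) adj-ab
      d-ab : d a b ≡ true
      d-ab = proj₂ (∧-≡-true⁻ ab)
      d-ba : d b a ≡ false
      d-ba = trans (valid a b adj-ab) (cong not d-ab)
      a≢b : a ≢ b
      a≢b = adj⇒≢ adj-ab

    outDeg-other : ∀ {x} → x ≢ a → x ≢ b → outDeg d′ x ≡ outDeg d x
    outDeg-other x≢a x≢b =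
      sum-cong-≗ (λ y → cong (λ t → indicator (adj G _ y ∧ t))
                             (reverse-outside d (x≢a ∘ proj₁) (x≢b ∘ proj₂)))

    outDeg-source : outDeg d a ≡ suc (outDeg d′ a)
    outDeg-source = count-insert b
      (λ y y≢b → cong (adj G a y ∧_) (reverse-outside d (y≢b ∘ proj₂) (a≢b ∘ proj₂)))
      (cong₂ _∧_ adj-ab (trans (cong (_xor d a b) (joins-self a b)) (cong not d-ab)))
      ab

    outDeg-target : outDeg d′ b ≡ suc (outDeg d b)
    outDeg-target = count-insert a
      (λ y y≢a → cong (adj G b y ∧_) (sym (reverse-outside d (a≢b ∘ sym ∘ proj₁) (y≢a ∘ proj₁))))
      (cong₂ _∧_ adj-ba d-ba)
      (cong₂ _∧_ adj-ba (trans (cong (_xor d b a) (trans (joins-sym a b a b) (joins-self a b))) (cong not d-ba)))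

    arc-kept : ∀ {x y} → x ≢ a → arcOf d x y ≡ true → arcOf d′ x y ≡ true
    arc-kept {x} {y} x≢a xy with (y ≟ a) ×-dec (x ≟ b)
    ... | yes (refl , refl) = contradiction (trans (sym (proj₂ (∧-≡-true⁻ xy))) d-ba) λ ()
    ... | no ¬ba            = trans (cong (adj G x y ∧_) (reverse-outside d (x≢a ∘ proj₁) ¬ba)) xy

  handshake : ∀ {d} → IsOrientation d → degreeSum G ≡ sum (outDeg d) + sum (outDeg d)
  handshake {d} valid = begin
    degreeSum G                                               ≡⟨ foldr-+-map-tabulate (degree G) (λ v → v) ⟩
    sum (degree G)                                            ≡⟨ sum-cong-≗ (λ v → countᵇ≡count (adj G v)) ⟩
    sum (λ u → count (adj G u))                               ≡⟨ sum-cong-≗ (λ u → count-split (adj G u) (d u)) ⟩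
    sum (λ u → outDeg d u + count (λ v → adj G u v ∧ not (d u v)))
                                                              ≡⟨ ∑-distrib-+ (outDeg d) _ ⟩
    sum (outDeg d) + sum (λ u → count (λ v → adj G u v ∧ not (d u v)))
                                                              ≡⟨ cong (sum (outDeg d) +_) in-degrees ⟩
    sum (outDeg d) + sum (outDeg d)                           ∎
    where
    open ≡-Reasoning
    backward : ∀ u v → adj G u v ∧ not (d u v) ≡ arcOf d v u
    backward u v with adj G u v in uv
    ... | true  = sym (cong₂ _∧_ (trans (symm G v u) uv) (valid u v uv))
    ... | false = sym (cong (_∧ d v u) (trans (symm G v u) uv))
    in-degrees : sum (λ u → count (λ v → adj G u v ∧ not (d u v))) ≡ sum (outDeg d)
    in-degrees = trans (sum-cong-≗ (λ u → sum-cong-≗ (λ v → cong indicator (backward u v))))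
                       (∑-comm (λ u v → indicator (arcOf d v u)))

  degreeSum-≤ : ∀ {d} k → IsOrientation d → (∀ u → outDeg d u ≤ k) → degreeSum G ≤ n * k + n * k
  degreeSum-≤ {d} k valid out≤k = subst (_≤ n * k + n * k) (sym (handshake valid))
    (+-mono-≤ (sum-≤-* (outDeg d) out≤k) (sum-≤-* (outDeg d) out≤k))

module Balancing {n} (G : SimpleGraph n) (k : ℕ) where

  deficit : Direction n → ℕ
  deficit d = sum (λ u → k ∸ outDeg G d u)

  data Reaches (d : Direction n) : ℕ → Fin n → Set where
    low  : ∀ {j u} → outDeg G d u < k → Reaches d j u
    step : ∀ {j u v} → arcOf G d u v ≡ true → Reaches d j v → Reaches d (suc j) u

  reaches? : ∀ d j → U.Decidable (Reaches d j)
  reaches? d j u with outDeg G d u <? k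
  ... | yes u-low = yes (low u-low)
  reaches? d zero    u | no ¬u-low = no λ { (low u-low) → ¬u-low u-low }
  reaches? d (suc j) u | no ¬u-low with any? (λ v → (arcOf G d u v Bool.≟ true) ×-dec reaches? d j v)
  ... | yes (v , uv , r) = yes (step uv r)
  ... | no ¬next         = no λ { (low u-low) → ¬u-low u-low ; (step uv r) → ¬next (_ , uv , r) }

  reaches-suc : ∀ {d j u} → Reaches d j u → Reaches d (suc j) u
  reaches-suc (low u-low) = low u-low
  reaches-suc (step uv r) = step uv (reaches-suc r)

  module _ {d} (valid : IsOrientation G d) {a b} (ab : arcOf G d a b ≡ true) (a-surplus : k < outDeg G d a) where
    open Reversal G valid ab

    deficit-pointwise : ∀ x → k ∸ outDeg G d′ x ≤ k ∸ outDeg G d x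
    -- Deciding x ≟ a instead would also abstract the x ≟ a hidden in d′ x = reverse d a b x.
    deficit-pointwise x with a ≟ x | b ≟ x
    ... | yes refl | _        =
      ≤-trans (≤-reflexive (m≤n⇒m∸n≡0 (≤-pred (subst (k <_) outDeg-source a-surplus)))) z≤n
    ... | no _     | yes refl = ∸-monoʳ-≤ k (≤-trans (n≤1+n _) (≤-reflexive (sym outDeg-target)))
    ... | no a≢x   | no b≢x   = ≤-reflexive (cong (k ∸_) (outDeg-other (a≢x ∘ sym) (b≢x ∘ sym)))

    deficit-reverse-≤ : deficit d′ ≤ deficit d
    deficit-reverse-≤ = sum-mono-≤ deficit-pointwise

    deficit-reverse-< : outDeg G d b < k → deficit d′ < deficit d
    deficit-reverse-< b-low = sum-mono-< deficit-pointwise b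
      (∸-monoʳ-< (≤-reflexive (sym outDeg-target)) (subst (_≤ k) (sym outDeg-target) b-low))

    surplus-moves : k ≤ outDeg G d b → k < outDeg G d′ b
    surplus-moves b-full = subst (k <_) (sym outDeg-target) (s≤s b-full)

    reaches-reverse : ∀ {j y} → k ≤ outDeg G d b → ¬ Reaches d j a → Reaches d j y → Reaches d′ j y
    reaches-reverse b-full ¬a (low y-low) = low (subst (_< k) (sym (outDeg-other y≢a y≢b)) y-low)
      where
      y≢a = λ { refl → ¬a (low y-low) }
      y≢b = λ { refl → <⇒≱ y-low b-full }
    reaches-reverse b-full ¬a (step yv r) = step (arc-kept y≢a yv) (reaches-reverse b-full (¬a ∘ reaches-suc) r)
      where
      y≢a = λ { refl → ¬a (step yv r) }

  -- Reversing u → v moves one unit of out-degree from u to v. If v was below k the deficit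
  -- drops; otherwise v inherits the surplus, and its shorter path to a low vertex survives
  -- the reversal because u (which has no path that short) is not on it.
  augment : ∀ j {d u} → IsOrientation G d → Reaches d j u → k < outDeg G d u →
            ∃[ d′ ] IsOrientation G d′ × deficit d′ < deficit d
  augment j       valid (low u-low) u-surplus = ⊥-elim (<-asym u-low u-surplus)
  augment (suc j) {d} {u} valid (step {v = v} uv r) u-surplus with reaches? d j u
  ... | yes r′ = augment j valid r′ u-surplus
  ... | no ¬r′ with outDeg G d v <? k
  ...   | yes v-low  = reverse G d u v , reverse-orientation G u v valid , deficit-reverse-< valid uv u-surplus v-low
  ...   | no ¬v-low
        with augment j (reverse-orientation G u v valid)
                       (reaches-reverse valid uv u-surplus (≮⇒≥ ¬v-low) ¬r′ r)
                       (surplus-moves valid uv u-surplus (≮⇒≥ ¬v-low))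
  ...     | d″ , valid″ , smaller = d″ , valid″ , <-≤-trans smaller (deficit-reverse-≤ valid uv u-surplus)

  record Balanced : Set where
    field
      dir              : Direction n
      isOrientation    : IsOrientation G dir
      sink             : Fin n → Bool
      sink-pred-closed : ∀ u v → arcOf G dir u v ≡ true → sink v ≡ true → sink u ≡ true
      sink-out≤        : ∀ u → sink u ≡ true → outDeg G dir u ≤ k
      source-out≥      : ∀ u → sink u ≡ false → k ≤ outDeg G dir u

  balance : ∀ d → IsOrientation G d → Acc _<_ (deficit d) → Balanced
  balance d valid (acc smaller) with stabilise (Reaches d) (reaches? d) reaches-suc
  ... | j , stable with any? (λ u → reaches? d j u ×-dec k <? outDeg G d u)
  ...   | yes (u , r , u-surplus) with augment j valid r u-surplus
  ...     | d′ , valid′ , d′<d = balance d′ valid′ (smaller d′<d)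
  balance d valid (acc smaller) | j , stable | no no-surplus = record
    { dir              = d
    ; isOrientation    = valid
    ; sink             = λ u → does (reaches? d j u)
    ; sink-pred-closed = λ u v uv r → dec-true (reaches? d j u) (stable (step uv (does-true⁻ (reaches? d j v) r)))
    ; sink-out≤        = λ u r → ≮⇒≥ λ u-surplus → no-surplus (u , does-true⁻ (reaches? d j u) r , u-surplus)
    ; source-out≥      = λ u ¬r → ≮⇒≥ (λ u-low → not-¬ ¬r (dec-true (reaches? d j u) (low u-low)))
    }

  balanced : Balanced
  balanced = balance (byIndex G) (byIndex-orientation G) (<-wellFounded _)

module _ {n} (G : SimpleGraph n) {k : ℕ} (B : Balancing.Balanced G k) where
  open Balancing.Balanced B

  private
    χ : Fin n → Bool
    χ u = not (sink u)

  core-orientation : Orientation G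
  core-orientation = toOrientation G (redirect-orientation G χ isOrientation)

  balanced-core : Core core-orientation k
  balanced-core = record { member = χ ; pred-closed = redirect-pred-closed G χ dir ; out-degree = out-degree }
    where
    out-degree : ∀ u → χ u ≡ true → k ≤ count (λ w → arcOf G (redirect G χ dir) u w ∧ χ w)
    out-degree u u∈χ = ≤-trans (source-out≥ u su) (count-mono lands)
      where
      su : sink u ≡ false
      su = not-injective u∈χ
      lands : ∀ w → arcOf G dir u w ≡ true → arcOf G (redirect G χ dir) u w ∧ χ w ≡ true
      lands w uw with sink w in sw
      ... | true  = contradiction (sink-pred-closed u w uw sw) (not-¬ su)
      ... | false rewrite su = ∧-≡-true⁺ uw refl

  balanced-core-nonempty : n * k + n * k < degreeSum G → ∃[ u ] χ u ≡ true
  balanced-core-nonempty dense with any? (λ u → sink u Bool.≟ false)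
  ... | yes (u , su) = u , cong not su
  ... | no all-sinks = ⊥-elim (<⇒≱ dense (degreeSum-≤ G k isOrientation out≤k))
    where
    out≤k : ∀ u → outDeg G dir u ≤ k
    out≤k u with sink u in su
    ... | true  = sink-out≤ u su
    ... | false = ⊥-elim (all-sinks (u , su))

dense⇒F≥ : ∀ {n} (G : SimpleGraph n) k → n * k + n * k < degreeSum G → Σ (Orientation G) (λ D → F≥ D k)
dense⇒F≥ G k dense = core-orientation G B , core⇒F≥ _ k (balanced-core G B) (balanced-core-nonempty G B dense)
  where
  B = Balancing.balanced G k

quarter-average⇒dense : ∀ N k D → suc k * (4 * suc N) ≤ D + suc N → suc N * suc k + suc N * suc k < D
quarter-average⇒dense N k D k≤avg = begin-strict
  X + X       <⟨ m<m+n (X + X) z<s ⟩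
  X + X + X   ≤⟨ +-cancelʳ-≤ X (X + X + X) D four-X≤D+X ⟩
  D           ∎
  where
  open ≤-Reasoning
  X : ℕ
  X = suc N * suc k
  four-copies : ∀ a b → a * b + a * b + a * b + a * b ≡ b * (4 * a)
  four-copies = solve-∀
  four-X≤D+X : X + X + X + X ≤ D + X
  four-X≤D+X = begin
    X + X + X + X       ≡⟨ four-copies (suc N) (suc k) ⟩
    suc k * (4 * suc N) ≤⟨ k≤avg ⟩
    D + suc N           ≤⟨ +-monoʳ-≤ D (m≤m*n (suc N) (suc k)) ⟩
    D + X               ∎

proposition3p17 : (m : ℕ) (G : SimpleGraph (suc m)) →
    (∀ v → 2 ≤ degree G v) →
    Σ (Orientation G) (λ D →
      F≥ D ((degreeSum G + suc m) / (4 * suc m)))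
proposition3p17 m G _ with (degreeSum G + suc m) / (4 * suc m) | m/n*n≤m (degreeSum G + suc m) (4 * suc m)
... | zero  | _     = toOrientation G (byIndex-orientation G) , λ _ _ → z≤n
... | suc k | k≤avg = dense⇒F≥ G (suc k) (quarter-average⇒dense m k (degreeSum G) k≤avg)
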